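{- Let $d$ be either $0$ or a positive square-free integer, $K=\mathbb{Q}(\sqrt{ -d})$, $R$ the ring of integers of $K$. Then the induced subgraph $\Gamma_{S_{tc}(R)}(M_2(R))$ of $\Gamma(M_2(R))$ on the vertex set $S_{tc}(R)$ decomposes into connected components as follows. (Case 1) If $d\neq 1,3$: (1) a component $\Gamma_1$ with vertex set $S_{tc,1,0}(R)\cup S_{tc,2}(R)$, which is an (undirected) infinite complete bipartite graph with girth $g(\Gamma_1)=4$; (2) a component $\Gamma_2$ with vertex set $S_{tc,1,-1}(R)\cup S_{tc,1,1}(R)$, which is a directed infinite graph whose underlying undirected graph $\Gamma_2^{un}$ has girth $3$; (3) all remaining vertices, namely those in $S_{tc,1,t}(R)$ with $t\in R$, $t\neq 0,\pm1$, are isolated vertices (components $K_1$). (Case 2) If $d=1$ (with $i=\sqrt{ -1}$): (1) a component $\Gamma_1$ with vertex set $S_{tc,1,0}(R)\cup S_{tc,2}(R)$, an (undirected) infinite complete bipartite graph with $g(\Gamma_1)=4$; (2) a component $\Gamma_2$ with vertex set $S_{tc,1,-1}(R)\cup S_{tc,1,1}(R)\cup S_{tc,1,i}(R)\cup S_{tc,1,-i}(R)$, a directed infinite graph with $g(\Gamma_2^{un})=3$; (3) all vertices in $S_{tc,1,t}(R)$ with $t\neq 0,\pm1,\pm i$ are isolated vertices. (Case 3) If $d=3$ (with $\omega$ a primitive third root of unity): (1) a component $\Gamma_1$ with vertex set $S_{tc,1,0}(R)\cup S_{tc,2}(R)$, an (undirected) infinite complete bipartite graph with $g(\Gamma_1)=4$;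 (2) a component $\Gamma_2$ with vertex set $S_{tc,1,-1}(R)\cup S_{tc,1,1}(R)$, a directed infinite graph with $g(\Gamma_2^{un})=3$; (3) a component $\Gamma_3$ with vertex set $S_{tc,1,\omega}(R)\cup S_{tc,1,-\omega}(R)$, a directed infinite graph with $g(\Gamma_3^{un})=3$; (4) a component $\Gamma_4$ with vertex set $S_{tc,1,\omega^2}(R)\cup S_{tc,1,-\omega^2}(R)$, a directed infinite graph with $g(\Gamma_4^{un})=3$; (5) all vertices in $S_{tc,1,t}(R)$ with $t\neq 0,\pm1,\pm\omega,\pm\omega^2$ are isolated vertices.
   Context: For a ring $S$ with identity, $Z(S)$ is the set of all (left or right) zero-divisors and $Z(S)^\times=Z(S)\setminus\{0\}$. The zero-divisor graph $\Gamma(S)$ is the directed graph with vertex set $Z(S)^\times$ and an edge $v_1\to v_2$ between distinct vertices iff $v_1v_2=0$; its underlying undirected graph has $v_1,v_2$ adjacent iff $v_1v_2=0$ or $v_2v_1=0$. For a subset $T\subseteq Z(S)^\times$, $\Gamma_T(S)$ is the induced subgraph on $T$. For $t\in R$ define $S_{tc,1,t}(R)=\{\lambda\begin{bmatrix}1&t\\t^2&t^3\end{bmatrix}:\lambda\in R\setminus\{0\}\}$, $S_{tc,1}(R)=\bigcup_{t\in R}S_{tc,1,t}(R)$, $S_{tc,2}(R)=\{\begin{bmatrix}0&0\\0&\lambda\end{bmatrix}:\lambda\in R\setminus\{0\}\}$, and $S_{tc}(R)=S_{tc,1}(R)\cup S_{tc,2}(R)\subseteq Z(M_2(R))^\times$.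 Girth $g$ is the length of a shortest cycle; for a directed graph $\Gamma$, $\Gamma^{un}$ is its underlying undirected graph. When $d=0$, $R=\mathbb{Z}$. -}

module Defs where

open import Level using (Level)
open import Data.Nat as ℕ using (ℕ; zero; suc)
open import Data.Nat.Divisibility using (_∣_)
open import Data.Integer as ℤ using (ℤ; +_)
open import Data.Bool using (Bool; if_then_else_)
open import Data.Empty using (⊥)
open import Data.Product using (Σ; Σ-syntax; _×_; _,_)
open import Data.Sum using (_⊎_)
open import Data.Fin as Fin using (Fin; inject₁; fromℕ)
open import Relation.Binary.PropositionalEquality using (_≡_; _≢_)
open import Relation.Nullary using (¬_)
open import Relation.Binary.Construct.Closure.ReflexiveTransitive using (Star)
open import Function.Definitions using (Injective)

SquareFree : ℕ → Set
SquareFree d = ∀ p → (p ℕ.* p) ∣ d → p ≡ 1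

Admissible : ℕ → Set
Admissible d = d ≡ 0 ⊎ (1 ℕ.≤ d × SquareFree d)

-- The ring of integers R of Q(√-d).
--   d = 0            : R = ℤ
--   d ≡ 1,2 (mod 4)  : R = ℤ[θ], θ = √-d,          θ² = -d
--   d ≡ 3   (mod 4)  : R = ℤ[θ], θ = (1+√-d)/2,    θ² = θ - (d+1)/4
-- For d ≥ 1 an element a + bθ is represented by the pair (a , b).

isThreeMod4 : ℕ → Bool
isThreeMod4 d = (d ℕ.% 4) ℕ.≡ᵇ 3

-- θ² = θp d · θ + θq d
θp : ℕ → ℤ
θp d = if isThreeMod4 d then + 1 else + 0

θq : ℕ → ℤ
θq d = if isThreeMod4 d then ℤ.- (+ (suc d ℕ./ 4)) else ℤ.- (+ d)

R : ℕ → Set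
R zero    = ℤ
R (suc n) = ℤ × ℤ

zeroR : ∀ d → R d
zeroR zero    = + 0
zeroR (suc n) = + 0 , + 0

oneR : ∀ d → R d
oneR zero    = + 1
oneR (suc n) = + 1 , + 0

negR : ∀ d → R d → R d
negR zero    x       = ℤ.- x
negR (suc n) (a , b) = ℤ.- a , ℤ.- b

addR : ∀ d → R d → R d → R d
addR zero    x       y       = x ℤ.+ y
addR (suc n) (a , b) (c , e) = a ℤ.+ c , b ℤ.+ e

mulR : ∀ d → R d → R d → R d
mulR zero    x       y       = x ℤ.* y
mulR (suc n) (a , b) (c , e) =
  a ℤ.* c ℤ.+ b ℤ.* e ℤ.* θq (suc n) ,
  a ℤ.* e ℤ.+ b ℤ.* c ℤ.+ b ℤ.* e ℤ.* θp (suc n)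

record M2 (A : Set) : Set where
  constructor mat
  field
    e11 e12 e21 e22 : A

module _ (d : ℕ) where

  private
    _+_ : R d → R d → R d
    _+_ = addR d
    _*_ : R d → R d → R d
    _*_ = mulR d
    infixl 6 _+_
    infixl 7 _*_
    0# : R d
    0# = zeroR d
    1# : R d
    1# = oneR d

  Mat : Set
  Mat = M2 (R d)

  zeroM : Mat
  zeroM = mat 0# 0# 0# 0#

  mulM : Mat → Mat → Mat
  mulM (mat a b c e) (mat a' b' c' e') =
    mat (a * a' + b * c') (a * b' + b * e')
        (c * a' + e * c') (c * b' + e * e')

  tcMat : R d → R d → Mat
  tcMat l t = mat l (l * t) (l * (t * t)) (l * (t * (t * t)))

  Stc1t : R d → Mat → Set
  Stc1t t M = Σ[ l ∈ R d ] (l ≢ 0# × M ≡ tcMat l t)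

  Stc1 : Mat → Set
  Stc1 M = Σ[ t ∈ R d ] Stc1t t M

  Stc2 : Mat → Set
  Stc2 M = Σ[ l ∈ R d ] (l ≢ 0# × M ≡ mat 0# 0# 0# l)

  Stc : Mat → Set
  Stc M = Stc1 M ⊎ Stc2 M

  Edge : Mat → Mat → Set
  Edge u v = u ≢ v × mulM u v ≡ zeroM

  Adj : Mat → Mat → Set
  Adj u v = u ≢ v × (mulM u v ≡ zeroM ⊎ mulM v u ≡ zeroM)

  Step : Mat → Mat → Set
  Step u v = Stc u × Stc v × Adj u v

  IsComponent : (Mat → Set) → Set
  IsComponent C =
    (Σ[ v ∈ Mat ] C v) ×
    (∀ v → C v → Stc v) ×
    (∀ u v → C u → C v → Star Step u v) ×
    (∀ u v → C u → Stc v → Adj u v → C v)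

  Infinite : (Mat → Set) → Set
  Infinite C = Σ[ f ∈ (ℕ → Mat) ] ((∀ n → C (f n)) × Injective _≡_ _≡_ f)

  Undirected : (Mat → Set) → Set
  Undirected C = ∀ u v → C u → C v → Edge u v → Edge v u

  Directed : (Mat → Set) → Set
  Directed C = Σ[ u ∈ Mat ] Σ[ v ∈ Mat ]
    (C u × C v × Edge u v × ¬ Edge v u)

  CompleteBipartite : (Mat → Set) → Set₁
  CompleteBipartite C = Σ[ P ∈ (Mat → Set) ] Σ[ Q ∈ (Mat → Set) ]
    ((∀ v → C v → P v ⊎ Q v) ×
     (∀ v → P v → C v) × (∀ v → Q v → C v) ×
     (∀ v → P v → Q v → ⊥) ×
     (Σ[ v ∈ Mat ] P v) × (Σ[ v ∈ Mat ] Q v) ×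
     (∀ u v → C u → C v →
        (Adj u v → (P u × Q v) ⊎ (Q u × P v)) ×
        ((P u × Q v) ⊎ (Q u × P v) → Adj u v)))

  HasCycle : (Mat → Set) → ℕ → Set
  HasCycle C zero    = ⊥
  HasCycle C (suc m) = 2 ℕ.≤ m × Σ[ f ∈ (Fin (suc m) → Mat) ]
    (Injective _≡_ _≡_ f × (∀ i → C (f i)) ×
     (∀ (i : Fin m) → Adj (f (inject₁ i)) (f (Fin.suc i))) ×
     Adj (f (fromℕ m)) (f Fin.zero))

  Girth : (Mat → Set) → ℕ → Set
  Girth C g = HasCycle C g × (∀ n → n ℕ.< g → ¬ HasCycle C n)

  BipartiteComponent : (Mat → Set) → Set₁
  BipartiteComponent C =
    IsComponent C × Infinite C × Undirected C × CompleteBipartite C × Girth C 4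

  DirectedComponent : (Mat → Set) → Set
  DirectedComponent C =
    IsComponent C × Infinite C × Directed C × Girth C 3

  IsolatedVertex : Mat → Set
  IsolatedVertex v = IsComponent (λ u → u ≡ v)

  Γ₁ : Mat → Set
  Γ₁ M = Stc1t 0# M ⊎ Stc2 M

  PairSet : R d → Mat → Set
  PairSet t M = Stc1t (negR d t) M ⊎ Stc1t t M

Case1 : ℕ → Set₁
Case1 d =
  BipartiteComponent d (Γ₁ d) ×
  DirectedComponent d (PairSet d (oneR d)) ×
  (∀ t → t ≢ zeroR d → t ≢ oneR d → t ≢ negR d (oneR d) →
     ∀ v → Stc1t d t v → IsolatedVertex d v)

iG : R 1
iG = + 0 , + 1

Case2 : Set₁
Case2 =
  BipartiteComponent 1 (Γ₁ 1) ×
  DirectedComponent 1 (λ M → PairSet 1 (oneR 1) M ⊎ PairSet 1 iG M) ×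
  (∀ t → t ≢ zeroR 1 → t ≢ oneR 1 → t ≢ negR 1 (oneR 1) →
     t ≢ iG → t ≢ negR 1 iG →
     ∀ v → Stc1t 1 t v → IsolatedVertex 1 v)

-- Case 3 : d = 3, R = ℤ[θ], θ = (1+√-3)/2, θ² = θ - 1.
-- ω = (-1+√-3)/2 = θ - 1 is a primitive cube root of unity.

ω : R 3
ω = ℤ.- (+ 1) , + 1

ω² : R 3
ω² = mulR 3 ω ω

Case3 : Set₁
Case3 =
  BipartiteComponent 3 (Γ₁ 3) ×
  DirectedComponent 3 (PairSet 3 (oneR 3)) ×
  DirectedComponent 3 (PairSet 3 ω) ×
  DirectedComponent 3 (PairSet 3 ω²) ×
  (∀ t → t ≢ zeroR 3 → t ≢ oneR 3 → t ≢ negR 3 (oneR 3) →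
     t ≢ ω → t ≢ negR 3 ω → t ≢ ω² → t ≢ negR 3 ω² →
     ∀ v → Stc1t 3 t v → IsolatedVertex 3 v)

-- For λ, μ ≠ 0 and A_t = [[1, t], [t², t³]] one computes
--   λA_t · μA_s = λμ (1 + t s²) · [[1, s], [t², t² s]],
-- while λA_t and D_μ = [[0, 0], [0, μ]] annihilate each other (in either order) exactly when t = 0,
-- and D_μ D_ν ≠ 0.  As R is an integral domain, λA_t and μA_s are adjacent iff 1 + t s² = 0 or
-- 1 + s t² = 0; either equation makes t and s units.  Hence S_{tc,1,0} ∪ S_{tc,2} is a complete
-- bipartite component, S_{tc,1,t} consists of isolated vertices when t ≠ 0 is not a unit, and every
-- other component is a union of sets S_{tc,1,t} over units t.  The units are read off the norm
-- form: ±1 for d ≠ 1, 3, the fourth roots of unity for d = 1 and the sixth roots of unity for d = 3.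
-- If t³ = 1 then -t is adjacent to both ±t, and a neighbour s of ±t is again ±t unless s t² is a
-- square root of -1; so for d ≠ 1 the components are the pairs {±t} with t³ = 1, whereas for d = 1
-- all four units are linked, since 1 + (±i)² = 0.

module Submission where

open import Defs
open import Level using (0ℓ)
open import Data.Bool using (true; false; T; if_then_else_)
open import Data.Unit using (tt)
open import Data.Nat as ℕ using (ℕ; zero; suc; _≤_; z≤n; s≤s)
import Data.Nat.Properties as ℕₚ
open import Data.Nat.DivMod using (m≡m%n+[m/n]*n; m*n/n≡m)
open import Data.Integer using (ℤ; +_; -[1+_]; ∣_∣)
import Data.Integer.Properties as ℤₚ
open import Data.Integer.Tactic.RingSolver using (solve-∀)
open import Data.Fin as Fin using (Fin; toℕ)
import Data.Fin.Properties as Finₚ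
open import Data.Product using (Σ; Σ-syntax; _×_; _,_; proj₁; proj₂)
open import Data.Sum using (_⊎_; inj₁; inj₂; [_,_]′)
import Data.Sum as Sum
open import Data.Empty using (⊥; ⊥-elim)
open import Function using (id; _∘_; _$_)
open import Relation.Nullary using (¬_)
open import Relation.Binary.PropositionalEquality
open import Relation.Binary.Construct.Closure.ReflexiveTransitive using (Star; ε; _◅_; _◅◅_; reverse)
open import Algebra.Structures using (IsCommutativeRing)
open import Algebra.Bundles using (CommutativeRing)
open import Algebra.Consequences.Propositional using (comm∧idˡ⇒id; comm∧distrˡ⇒distrʳ)
import Algebra.Properties.Ring as RingProperties

square-mono : ∀ {m n} → m ≤ n → m ℕ.* m ≤ n ℕ.* n
square-mono m≤n = ℕₚ.*-mono-≤ m≤n m≤n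

square≡0 : ∀ n → n ℕ.* n ≡ 0 → n ≡ 0
square≡0 n eq = [ id , id ]′ (ℕₚ.m*n≡0⇒m≡0∨n≡0 n eq)

square≡4 : ∀ n → n ℕ.* n ≡ 4 → n ≡ 2
square≡4 2 _ = refl
square≡4 (suc (suc (suc n))) eq with subst (9 ≤_) eq (square-mono {3} (s≤s (s≤s (s≤s z≤n))))
... | s≤s (s≤s (s≤s (s≤s ())))

sum-of-squares≡0 : ∀ U D B → 1 ≤ D → U ℕ.* U ℕ.+ D ℕ.* (B ℕ.* B) ≡ 0 → U ≡ 0 × B ≡ 0
sum-of-squares≡0 U (suc D) B _ eq =
  square≡0 U (ℕₚ.m+n≡0⇒m≡0 (U ℕ.* U) eq) ,
  square≡0 B (ℕₚ.m+n≡0⇒m≡0 (B ℕ.* B) (ℕₚ.m+n≡0⇒n≡0 (U ℕ.* U) eq))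

summand≤4 : ∀ U D B → U ℕ.* U ℕ.+ D ℕ.* (B ℕ.* B) ≡ 4 → D ℕ.* (B ℕ.* B) ≤ 4
summand≤4 U D B eq = subst (D ℕ.* (B ℕ.* B) ≤_) eq (ℕₚ.m≤n+m _ (U ℕ.* U))

sum-of-squares≡4 : ∀ U D B → 5 ≤ D → U ℕ.* U ℕ.+ D ℕ.* (B ℕ.* B) ≡ 4 → U ≡ 2 × B ≡ 0
sum-of-squares≡4 U D zero _ eq =
  square≡4 U (trans (sym (ℕₚ.+-identityʳ _)) (subst (λ x → U ℕ.* U ℕ.+ x ≡ 4) (ℕₚ.*-zeroʳ D) eq)) , refl
sum-of-squares≡4 U D (suc B) 5≤D eq =
  ⊥-elim (ℕₚ.<⇒≱ 5≤D (ℕₚ.≤-trans (ℕₚ.m≤m*n D (suc B ℕ.* suc B)) (summand≤4 U D (suc B) eq)))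

sum-of-squares≡4⇒≤1 : ∀ U D B → 3 ≤ D → U ℕ.* U ℕ.+ D ℕ.* (B ℕ.* B) ≡ 4 → B ≤ 1
sum-of-squares≡4⇒≤1 U D zero _ _ = z≤n
sum-of-squares≡4⇒≤1 U D (suc zero) _ _ = s≤s z≤n
sum-of-squares≡4⇒≤1 U D (suc (suc B)) 3≤D eq
  with ℕₚ.≤-trans (ℕₚ.*-mono-≤ 3≤D (square-mono {2} (s≤s (s≤s z≤n)))) (summand≤4 U D (suc (suc B)) eq)
... | s≤s (s≤s (s≤s (s≤s ())))

module RingOfIntegers where

  open import Data.Integer using (_+_; _*_; -_)

  ∣i∣≡1⇒ : ∀ i → ∣ i ∣ ≡ 1 → i ≡ + 1 ⊎ i ≡ -[1+ 0 ]
  ∣i∣≡1⇒ (+ .1) refl = inj₁ refl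
  ∣i∣≡1⇒ -[1+ .0 ] refl = inj₂ refl

  ∣i∣≤1⇒ : ∀ i → ∣ i ∣ ≤ 1 → i ≡ -[1+ 0 ] ⊎ i ≡ + 0 ⊎ i ≡ + 1
  ∣i∣≤1⇒ (+ 0) _ = inj₂ (inj₁ refl)
  ∣i∣≤1⇒ (+ 1) _ = inj₂ (inj₂ refl)
  ∣i∣≤1⇒ -[1+ 0 ] _ = inj₁ refl
  ∣i∣≤1⇒ (+ suc (suc _)) (s≤s ())
  ∣i∣≤1⇒ -[1+ suc _ ] (s≤s ())

  square-∣∣ : ∀ i → i * i ≡ + (∣ i ∣ ℕ.* ∣ i ∣)
  square-∣∣ (+ n) = sym (ℤₚ.pos-* n n)
  square-∣∣ -[1+ n ] = refl

  private
    *-assoc₁ : ∀ p q a b c e f g →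
      (a * c + b * e * q) * f + (a * e + b * c + b * e * p) * g * q ≡
      a * (c * f + e * g * q) + b * (c * g + e * f + e * g * p) * q
    *-assoc₁ = solve-∀

    *-assoc₂ : ∀ p q a b c e f g →
      (a * c + b * e * q) * g + (a * e + b * c + b * e * p) * f + (a * e + b * c + b * e * p) * g * p ≡
      a * (c * g + e * f + e * g * p) + b * (c * f + e * g * q) + b * (c * g + e * f + e * g * p) * p
    *-assoc₂ = solve-∀

    *-comm₁ : ∀ q a b c e → a * c + b * e * q ≡ c * a + e * b * q
    *-comm₁ = solve-∀

    *-comm₂ : ∀ p a b c e → a * e + b * c + b * e * p ≡ c * b + e * a + e * b * p
    *-comm₂ = solve-∀

    *-identityˡ₁ : ∀ q a b → + 1 * a + + 0 * b * q ≡ a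
    *-identityˡ₁ = solve-∀

    *-identityˡ₂ : ∀ p a b → + 1 * b + + 0 * a + + 0 * b * p ≡ b
    *-identityˡ₂ = solve-∀

    distribˡ₁ : ∀ q a b c e f g →
      a * (c + f) + b * (e + g) * q ≡ (a * c + b * e * q) + (a * f + b * g * q)
    distribˡ₁ = solve-∀

    distribˡ₂ : ∀ p a b c e f g →
      a * (e + g) + b * (c + f) + b * (e + g) * p ≡ (a * e + b * c + b * e * p) + (a * g + b * f + b * g * p)
    distribˡ₂ = solve-∀

  R-isCommutativeRing : ∀ d → IsCommutativeRing _≡_ (addR d) (mulR d) (negR d) (zeroR d) (oneR d)
  R-isCommutativeRing zero = ℤₚ.+-*-isCommutativeRing
  R-isCommutativeRing d@(suc _) = record
    { isRing = record
      { +-isAbelianGroup = record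
        { isGroup = record
          { isMonoid = record
            { isSemigroup = record
              { isMagma = record { isEquivalence = isEquivalence ; ∙-cong = cong₂ (addR d) }
              ; assoc = λ (a , b) (c , e) (f , g) → cong₂ _,_ (ℤₚ.+-assoc a c f) (ℤₚ.+-assoc b e g)
              }
            ; identity = (λ (a , b) → cong₂ _,_ (ℤₚ.+-identityˡ a) (ℤₚ.+-identityˡ b))
                       , (λ (a , b) → cong₂ _,_ (ℤₚ.+-identityʳ a) (ℤₚ.+-identityʳ b))
            }
          ; inverse = (λ (a , b) → cong₂ _,_ (ℤₚ.+-inverseˡ a) (ℤₚ.+-inverseˡ b))
                    , (λ (a , b) → cong₂ _,_ (ℤₚ.+-inverseʳ a) (ℤₚ.+-inverseʳ b))
          ; ⁻¹-cong = cong (negR d)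
          }
        ; comm = λ (a , b) (c , e) → cong₂ _,_ (ℤₚ.+-comm a c) (ℤₚ.+-comm b e)
        }
      ; *-cong = cong₂ (mulR d)
      ; *-assoc = λ (a , b) (c , e) (f , g) → cong₂ _,_ (*-assoc₁ p q a b c e f g) (*-assoc₂ p q a b c e f g)
      ; *-identity = comm∧idˡ⇒id *-comm (λ (a , b) → cong₂ _,_ (*-identityˡ₁ q a b) (*-identityˡ₂ p a b))
      ; distrib = distribˡ , comm∧distrˡ⇒distrʳ *-comm distribˡ
      }
    ; *-comm = *-comm
    }
    where
    p = θp d
    q = θq d
    *-comm : ∀ x y → mulR d x y ≡ mulR d y x
    *-comm (a , b) (c , e) = cong₂ _,_ (*-comm₁ q a b c e) (*-comm₂ p a b c e)
    distribˡ : ∀ x y z → mulR d x (addR d y z) ≡ addR d (mulR d x y) (mulR d x z)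
    distribˡ (a , b) (c , e) (f , g) = cong₂ _,_ (distribˡ₁ q a b c e f g) (distribˡ₂ p a b c e f g)

  R-commutativeRing : ℕ → CommutativeRing 0ℓ 0ℓ
  R-commutativeRing d = record { isCommutativeRing = R-isCommutativeRing d }

  disc : ℕ → ℕ
  disc d = if isThreeMod4 d then d else 4 ℕ.* d

  norm : ∀ n → R (suc n) → ℤ
  norm n (a , b) = a * a + θp (suc n) * (a * b) + - θq (suc n) * (b * b)

  private
    norm-*-identity : ∀ p q a b c e →
      (a * c + b * e * q) * (a * c + b * e * q) + p * ((a * c + b * e * q) * (a * e + b * c + b * e * p))
        + - q * ((a * e + b * c + b * e * p) * (a * e + b * c + b * e * p))
      ≡ (a * a + p * (a * b) + - q * (b * b)) * (c * c + p * (c * e) + - q * (e * e))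
    norm-*-identity = solve-∀

    four-norm-identity : ∀ p q a b →
      + 4 * (a * a + p * (a * b) + - q * (b * b)) ≡
      (+ 2 * a + p * b) * (+ 2 * a + p * b) + - (p * p + + 4 * q) * (b * b)
    four-norm-identity = solve-∀

    norm-0-identity : ∀ p q → + 0 * + 0 + p * (+ 0 * + 0) + - q * (+ 0 * + 0) ≡ + 0
    norm-0-identity = solve-∀

    norm-1-identity : ∀ p q → + 1 * + 1 + p * (+ 1 * + 0) + - q * (+ 0 * + 0) ≡ + 1
    norm-1-identity = solve-∀

    norm-swap-identity : ∀ p a b → a * a + p * (a * b) + + 1 * (b * b) ≡ b * b + p * (b * a) + + 1 * (a * a)
    norm-swap-identity = solve-∀

  norm-* : ∀ n x y → norm n (mulR (suc n) x y) ≡ norm n x * norm n y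
  norm-* n (a , b) (c , e) = norm-*-identity (θp (suc n)) (θq (suc n)) a b c e

  θ-disc : ∀ n → θp (suc n) * θp (suc n) + + 4 * θq (suc n) ≡ - + disc (suc n)
  θ-disc n with isThreeMod4 (suc n) in eq
  ... | false = cong -_ (sym (ℤₚ.pos-* 4 (suc n)))
  ... | true = begin
    + 1 + + 4 * - + K        ≡⟨ cong (λ k → + 1 + k) (sym (ℤₚ.neg-distribʳ-* (+ 4) (+ K))) ⟩
    + 1 + - (+ 4 * + K)      ≡⟨ cong (λ k → + 1 + - k) (sym (ℤₚ.pos-* 4 K)) ⟩
    + 1 + - + (4 ℕ.* K)      ≡⟨ cong (λ k → + 1 + - + k) 4K≡2+n ⟩
    - + suc n                ∎
    where
    open ≡-Reasoning
    K = suc (suc n) ℕ./ 4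
    n≡3+[n/4]*4 : suc n ≡ 3 ℕ.+ (suc n ℕ./ 4) ℕ.* 4
    n≡3+[n/4]*4 = trans (m≡m%n+[m/n]*n (suc n) 4)
                        (cong (ℕ._+ (suc n ℕ./ 4) ℕ.* 4) (ℕₚ.≡ᵇ⇒≡ (suc n ℕ.% 4) 3 (subst T (sym eq) tt)))
    4K≡2+n : 4 ℕ.* K ≡ suc (suc n)
    4K≡2+n = begin
      4 ℕ.* K                                  ≡⟨ cong (λ m → 4 ℕ.* (suc m ℕ./ 4)) n≡3+[n/4]*4 ⟩
      4 ℕ.* (suc (suc n ℕ./ 4) ℕ.* 4 ℕ./ 4)   ≡⟨ cong (4 ℕ.*_) (m*n/n≡m (suc (suc n ℕ./ 4)) 4) ⟩
      4 ℕ.* suc (suc n ℕ./ 4)                  ≡⟨ ℕₚ.*-comm 4 _ ⟩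
      suc (suc n ℕ./ 4) ℕ.* 4                  ≡⟨ cong suc n≡3+[n/4]*4 ⟨
      suc (suc n)                              ∎

  1≤disc : ∀ n → 1 ≤ disc (suc n)
  1≤disc n with isThreeMod4 (suc n)
  ... | true = s≤s z≤n
  ... | false = s≤s z≤n

  module _ (n : ℕ) where

    private
      d = suc n
      p = θp d
      q = θq d

    four-norm : ∀ a b →
      + 4 * norm n (a , b) ≡
      + (∣ + 2 * a + p * b ∣ ℕ.* ∣ + 2 * a + p * b ∣ ℕ.+ disc d ℕ.* (∣ b ∣ ℕ.* ∣ b ∣))
    four-norm a b = begin
      + 4 * norm n (a , b)                    ≡⟨ four-norm-identity p q a b ⟩
      u * u + - (p * p + + 4 * q) * (b * b)   ≡⟨ cong (λ k → u * u + - k * (b * b)) (θ-disc n) ⟩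
      u * u + - - + D * (b * b)               ≡⟨ cong (λ k → u * u + k * (b * b)) (ℤₚ.neg-involutive (+ D)) ⟩
      u * u + + D * (b * b)                   ≡⟨ cong₂ (λ x y → x + + D * y) (square-∣∣ u) (square-∣∣ b) ⟩
      + UU + + D * + BB                       ≡⟨ cong (λ k → + UU + k) (ℤₚ.pos-* D BB) ⟨
      + UU + + (D ℕ.* BB)                     ≡⟨ ℤₚ.pos-+ UU (D ℕ.* BB) ⟨
      + (UU ℕ.+ D ℕ.* BB)                     ∎
      where
      open ≡-Reasoning
      u = + 2 * a + p * b
      D = disc d
      UU = ∣ u ∣ ℕ.* ∣ u ∣
      BB = ∣ b ∣ ℕ.* ∣ b ∣

    ∣2a+pb∣ : ∀ a b → b ≡ + 0 → ∣ + 2 * a + p * b ∣ ≡ 2 ℕ.* ∣ a ∣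
    ∣2a+pb∣ a .(+ 0) refl = begin
      ∣ + 2 * a + p * + 0 ∣  ≡⟨ cong (λ k → ∣ + 2 * a + k ∣) (ℤₚ.*-zeroʳ p) ⟩
      ∣ + 2 * a + + 0 ∣      ≡⟨ cong ∣_∣ (ℤₚ.+-identityʳ (+ 2 * a)) ⟩
      ∣ + 2 * a ∣            ≡⟨ ℤₚ.∣i*j∣≡∣i∣*∣j∣ (+ 2) a ⟩
      2 ℕ.* ∣ a ∣            ∎
      where open ≡-Reasoning

    norm≡0⇒≡0 : ∀ x → norm n x ≡ + 0 → x ≡ zeroR d
    norm≡0⇒≡0 (a , b) N≡0 = cong₂ _,_ (ℤₚ.∣i∣≡0⇒i≡0 ∣a∣≡0) b≡0
      where
      squares≡0 = sum-of-squares≡0 (∣ + 2 * a + p * b ∣) (disc d) ∣ b ∣ (1≤disc n)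
        (ℤₚ.+-injective (trans (sym (four-norm a b)) (cong (+ 4 *_) N≡0)))
      b≡0 = ℤₚ.∣i∣≡0⇒i≡0 (proj₂ squares≡0)
      ∣a∣≡0 : ∣ a ∣ ≡ 0
      ∣a∣≡0 = ℕₚ.*-cancelˡ-≡ ∣ a ∣ 0 2 (trans (sym (∣2a+pb∣ a b b≡0)) (proj₁ squares≡0))

    private
      norm-0 : norm n (zeroR d) ≡ + 0
      norm-0 = norm-0-identity p q
      norm-1 : norm n (oneR d) ≡ + 1
      norm-1 = norm-1-identity p q

    R-domain-suc : ∀ x y → mulR d x y ≡ zeroR d → x ≡ zeroR d ⊎ y ≡ zeroR d
    R-domain-suc x y xy≡0 =
      Sum.map (norm≡0⇒≡0 x) (norm≡0⇒≡0 y) (ℤₚ.i*j≡0⇒i≡0∨j≡0 (norm n x) NxNy≡0)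
      where
      NxNy≡0 : norm n x * norm n y ≡ + 0
      NxNy≡0 = trans (sym (norm-* n x y)) (trans (cong (norm n) xy≡0) norm-0)

    unit⇒∣norm∣≡1 : ∀ x y → mulR d x y ≡ oneR d → ∣ norm n x ∣ ≡ 1
    unit⇒∣norm∣≡1 x y xy≡1 = ℕₚ.m*n≡1⇒m≡1 ∣ norm n x ∣ ∣ norm n y ∣ (begin
      ∣ norm n x ∣ ℕ.* ∣ norm n y ∣  ≡⟨ ℤₚ.∣i*j∣≡∣i∣*∣j∣ (norm n x) (norm n y) ⟨
      ∣ norm n x * norm n y ∣        ≡⟨ cong ∣_∣ (norm-* n x y) ⟨
      ∣ norm n (mulR d x y) ∣        ≡⟨ cong (λ z → ∣ norm n z ∣) xy≡1 ⟩
      ∣ norm n (oneR d) ∣            ≡⟨ cong ∣_∣ norm-1 ⟩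
      1                              ∎)
      where open ≡-Reasoning

    norm≢-1 : ∀ x → norm n x ≢ -[1+ 0 ]
    norm≢-1 (a , b) N≡-1 = -[1+]≢+ (trans (cong (+ 4 *_) (sym N≡-1)) (four-norm a b))
      where
      -[1+]≢+ : ∀ {k m} → -[1+ k ] ≢ + m
      -[1+]≢+ ()

    unit⇒norm≡1 : ∀ x y → mulR d x y ≡ oneR d → norm n x ≡ + 1
    unit⇒norm≡1 x y xy≡1 =
      [ id , (λ N≡-1 → ⊥-elim (norm≢-1 x N≡-1)) ]′ (∣i∣≡1⇒ (norm n x) (unit⇒∣norm∣≡1 x y xy≡1))

    norm≡1⇒±1 : 5 ≤ disc d → ∀ x → norm n x ≡ + 1 → x ≡ oneR d ⊎ x ≡ negR d (oneR d)
    norm≡1⇒±1 5≤D (a , b) N≡1 =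
      Sum.map (λ a≡1 → cong₂ _,_ a≡1 b≡0) (λ a≡-1 → cong₂ _,_ a≡-1 b≡0) (∣i∣≡1⇒ a ∣a∣≡1)
      where
      squares = sum-of-squares≡4 (∣ + 2 * a + p * b ∣) (disc d) ∣ b ∣ 5≤D
        (ℤₚ.+-injective (trans (sym (four-norm a b)) (cong (+ 4 *_) N≡1)))
      b≡0 = ℤₚ.∣i∣≡0⇒i≡0 (proj₂ squares)
      ∣a∣≡1 : ∣ a ∣ ≡ 1
      ∣a∣≡1 = ℕₚ.*-cancelˡ-≡ ∣ a ∣ 1 2 (trans (sym (∣2a+pb∣ a b b≡0)) (proj₁ squares))

    norm-swap : q ≡ -[1+ 0 ] → ∀ a b → norm n (a , b) ≡ norm n (b , a)
    norm-swap q≡-1 a b = begin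
      a * a + p * (a * b) + - q * (b * b)    ≡⟨ cong (λ k → a * a + p * (a * b) + - k * (b * b)) q≡-1 ⟩
      a * a + p * (a * b) + + 1 * (b * b)    ≡⟨ norm-swap-identity p a b ⟩
      b * b + p * (b * a) + + 1 * (a * a)    ≡⟨ cong (λ k → b * b + p * (b * a) + - k * (a * a)) q≡-1 ⟨
      b * b + p * (b * a) + - q * (a * a)    ∎
      where open ≡-Reasoning

    norm≡1⇒∣b∣≤1 : 3 ≤ disc d → ∀ a b → norm n (a , b) ≡ + 1 → ∣ b ∣ ≤ 1
    norm≡1⇒∣b∣≤1 3≤D a b N≡1 = sum-of-squares≡4⇒≤1 (∣ + 2 * a + p * b ∣) (disc d) ∣ b ∣ 3≤D
      (ℤₚ.+-injective (trans (sym (four-norm a b)) (cong (+ 4 *_) N≡1)))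

    unit-box : q ≡ -[1+ 0 ] → 3 ≤ disc d →
      ∀ a b y → mulR d (a , b) y ≡ oneR d → ∣ a ∣ ≤ 1 × ∣ b ∣ ≤ 1
    unit-box q≡-1 3≤D a b y ab*y≡1 =
      norm≡1⇒∣b∣≤1 3≤D b a (trans (norm-swap q≡-1 b a) N≡1) , norm≡1⇒∣b∣≤1 3≤D a b N≡1
      where N≡1 = unit⇒norm≡1 (a , b) y ab*y≡1

  5≤disc : ∀ n → suc n ≢ 1 → suc n ≢ 3 → 5 ≤ disc (suc n)
  5≤disc 0 d≢1 _ = ⊥-elim (d≢1 refl)
  5≤disc 1 _ _ = s≤s (s≤s (s≤s (s≤s (s≤s z≤n))))
  5≤disc 2 _ d≢3 = ⊥-elim (d≢3 refl)
  5≤disc 3 _ _ = s≤s (s≤s (s≤s (s≤s (s≤s z≤n))))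
  5≤disc (suc (suc (suc (suc k)))) _ _ with isThreeMod4 (5 ℕ.+ k)
  ... | true = s≤s (s≤s (s≤s (s≤s (s≤s z≤n))))
  ... | false = s≤s (s≤s (s≤s (s≤s (s≤s z≤n))))

  R-domain : ∀ d x y → mulR d x y ≡ zeroR d → x ≡ zeroR d ⊎ y ≡ zeroR d
  R-domain zero x y = ℤₚ.i*j≡0⇒i≡0∨j≡0 x
  R-domain (suc n) = R-domain-suc n

  R-units : ∀ d → d ≢ 1 → d ≢ 3 → ∀ x y → mulR d x y ≡ oneR d → x ≡ oneR d ⊎ x ≡ negR d (oneR d)
  R-units zero _ _ x y xy≡1 =
    ∣i∣≡1⇒ x (ℕₚ.m*n≡1⇒m≡1 ∣ x ∣ ∣ y ∣ (trans (sym (ℤₚ.∣i*j∣≡∣i∣*∣j∣ x y)) (cong ∣_∣ xy≡1)))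
  R-units (suc n) d≢1 d≢3 x y xy≡1 = norm≡1⇒±1 n (5≤disc n d≢1 d≢3) x (unit⇒norm≡1 n x y xy≡1)

  Trit : ℤ → Set
  Trit i = i ≡ -[1+ 0 ] ⊎ i ≡ + 0 ⊎ i ≡ + 1

  GaussianUnit : R 1 → Set
  GaussianUnit x = (x ≡ negR 1 (oneR 1) ⊎ x ≡ oneR 1) ⊎ (x ≡ negR 1 iG ⊎ x ≡ iG)

  ℤ[i]-units : ∀ x y → mulR 1 x y ≡ oneR 1 → GaussianUnit x
  ℤ[i]-units (a , b) y ab*y≡1 =
    enumerate (∣i∣≤1⇒ a (proj₁ box)) (∣i∣≤1⇒ b (proj₂ box)) (unit⇒norm≡1 0 (a , b) y ab*y≡1)
    where
    box = unit-box 0 refl (s≤s (s≤s (s≤s z≤n))) a b y ab*y≡1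
    enumerate : ∀ {a b} → Trit a → Trit b → norm 0 (a , b) ≡ + 1 → GaussianUnit (a , b)
    enumerate (inj₁ refl)        (inj₂ (inj₁ refl)) _ = inj₁ (inj₁ refl)
    enumerate (inj₂ (inj₂ refl)) (inj₂ (inj₁ refl)) _ = inj₁ (inj₂ refl)
    enumerate (inj₂ (inj₁ refl)) (inj₁ refl)        _ = inj₂ (inj₁ refl)
    enumerate (inj₂ (inj₁ refl)) (inj₂ (inj₂ refl)) _ = inj₂ (inj₂ refl)
    enumerate (inj₂ (inj₁ refl)) (inj₂ (inj₁ refl)) ()
    enumerate (inj₁ refl)        (inj₁ refl)        ()
    enumerate (inj₁ refl)        (inj₂ (inj₂ refl)) ()
    enumerate (inj₂ (inj₂ refl)) (inj₁ refl)        ()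
    enumerate (inj₂ (inj₂ refl)) (inj₂ (inj₂ refl)) ()

  EisensteinUnit : R 3 → Set
  EisensteinUnit x = x ≡ oneR 3 ⊎ x ≡ negR 3 (oneR 3) ⊎ x ≡ ω ⊎ x ≡ negR 3 ω ⊎ x ≡ ω² ⊎ x ≡ negR 3 ω²

  ℤ[ω]-units : ∀ x y → mulR 3 x y ≡ oneR 3 → EisensteinUnit x
  ℤ[ω]-units (a , b) y ab*y≡1 =
    enumerate (∣i∣≤1⇒ a (proj₁ box)) (∣i∣≤1⇒ b (proj₂ box)) (unit⇒norm≡1 2 (a , b) y ab*y≡1)
    where
    box = unit-box 2 refl (s≤s (s≤s (s≤s z≤n))) a b y ab*y≡1
    enumerate : ∀ {a b} → Trit a → Trit b → norm 2 (a , b) ≡ + 1 → EisensteinUnit (a , b)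
    enumerate (inj₂ (inj₂ refl)) (inj₂ (inj₁ refl)) _ = inj₁ refl
    enumerate (inj₁ refl)        (inj₂ (inj₁ refl)) _ = inj₂ (inj₁ refl)
    enumerate (inj₁ refl)        (inj₂ (inj₂ refl)) _ = inj₂ (inj₂ (inj₁ refl))
    enumerate (inj₂ (inj₂ refl)) (inj₁ refl)        _ = inj₂ (inj₂ (inj₂ (inj₁ refl)))
    enumerate (inj₂ (inj₁ refl)) (inj₁ refl)        _ = inj₂ (inj₂ (inj₂ (inj₂ (inj₁ refl))))
    enumerate (inj₂ (inj₁ refl)) (inj₂ (inj₂ refl)) _ = inj₂ (inj₂ (inj₂ (inj₂ (inj₂ refl))))
    enumerate (inj₂ (inj₁ refl)) (inj₂ (inj₁ refl)) ()
    enumerate (inj₁ refl)        (inj₁ refl)        ()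
    enumerate (inj₂ (inj₂ refl)) (inj₂ (inj₂ refl)) ()

  R-1≢0 : ∀ d → oneR d ≢ zeroR d
  R-1≢0 zero ()
  R-1≢0 (suc _) ()

  R-2≢0 : ∀ d → addR d (oneR d) (oneR d) ≢ zeroR d
  R-2≢0 zero ()
  R-2≢0 (suc _) ()

  R-suc : ∀ d → ℕ → R d
  R-suc zero n = + suc n
  R-suc (suc _) n = + suc n , + 0

  R-suc≢0 : ∀ d n → R-suc d n ≢ zeroR d
  R-suc≢0 zero n ()
  R-suc≢0 (suc _) n ()

  R-suc-injective : ∀ d {m n} → R-suc d m ≡ R-suc d n → m ≡ n
  R-suc-injective zero refl = refl
  R-suc-injective (suc _) refl = refl

open RingOfIntegers

mat-cong : ∀ {A : Set} {a a′ b b′ c c′ e e′ : A} →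
  a ≡ a′ → b ≡ b′ → c ≡ c′ → e ≡ e′ → mat a b c e ≡ mat a′ b′ c′ e′
mat-cong refl refl refl refl = refl

module TcGraph (d : ℕ) where

  open CommutativeRing (R-commutativeRing d)
    using (_+_; _*_; -_; _-_; 0#; 1#; ring; *-commutativeMonoid; zeroˡ; zeroʳ; *-identityʳ;
           *-identityˡ; +-identityˡ; +-identityʳ; -‿inverseˡ; -‿inverseʳ; +-assoc; distribˡ; *-comm)
  open RingProperties ring
    using (-‿distribˡ-*; -‿distribʳ-*; -‿involutive; x[y-z]≈xy-xz; [y-z]x≈yx-zx; -1*x≈-x;
           +-inverseˡ-unique; +-inverseʳ-unique; x∙y⁻¹≈ε⇒x≈y)
  open import Algebra.Solver.CommutativeMonoid *-commutativeMonoid using (solve; _⊕_; _⊜_)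

  *-≢0 : ∀ {x y} → x ≢ 0# → y ≢ 0# → x * y ≢ 0#
  *-≢0 x≢0 y≢0 xy≡0 with R-domain d _ _ xy≡0
  ... | inj₁ x≡0 = x≢0 x≡0
  ... | inj₂ y≡0 = y≢0 y≡0

  *-cancelˡ : ∀ {x y z} → x ≢ 0# → x * y ≡ x * z → y ≡ z
  *-cancelˡ {x} {y} {z} x≢0 xy≡xz with R-domain d x (y - z) x[y-z]≡0
    where
    x[y-z]≡0 : x * (y - z) ≡ 0#
    x[y-z]≡0 = trans (x[y-z]≈xy-xz x y z) (trans (cong (_- x * z) xy≡xz) (-‿inverseʳ (x * z)))
  ... | inj₁ x≡0 = ⊥-elim (x≢0 x≡0)
  ... | inj₂ y-z≡0 = x∙y⁻¹≈ε⇒x≈y y z y-z≡0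

  difference-of-squares : ∀ x y → (x - y) * (x + y) ≡ x * x - y * y
  difference-of-squares x y = begin
    (x - y) * (x + y)                  ≡⟨ distribˡ (x - y) x y ⟩
    (x - y) * x + (x - y) * y          ≡⟨ cong₂ _+_ ([y-z]x≈yx-zx x x y) ([y-z]x≈yx-zx y x y) ⟩
    (x * x - y * x) + (x * y - y * y)  ≡⟨ cong (λ z → (x * x - z) + (x * y - y * y)) (*-comm y x) ⟩
    (x * x - x * y) + (x * y - y * y)  ≡⟨ +-assoc (x * x) (- (x * y)) _ ⟩
    x * x + (- (x * y) + (x * y - y * y)) ≡⟨ cong (λ z → x * x + z) (+-assoc (- (x * y)) (x * y) _) ⟨
    x * x + ((- (x * y) + x * y) - y * y) ≡⟨ cong (λ z → x * x + (z - y * y)) (-‿inverseˡ (x * y)) ⟩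
    x * x + (0# - y * y)               ≡⟨ cong (λ z → x * x + z) (+-identityˡ (- (y * y))) ⟩
    x * x - y * y                      ∎
    where open ≡-Reasoning

  square-root : ∀ {x y} → x * x ≡ y * y → x ≡ y ⊎ x ≡ - y
  square-root {x} {y} xx≡yy with R-domain d (x - y) (x + y) [x-y][x+y]≡0
    where
    [x-y][x+y]≡0 : (x - y) * (x + y) ≡ 0#
    [x-y][x+y]≡0 = trans (difference-of-squares x y) (trans (cong (_- y * y) xx≡yy) (-‿inverseʳ (y * y)))
  ... | inj₁ x-y≡0 = inj₁ (x∙y⁻¹≈ε⇒x≈y x y x-y≡0)
  ... | inj₂ x+y≡0 = inj₂ (+-inverseˡ-unique x y x+y≡0)

  1+x≡0⇒x≡-1 : ∀ {x} → 1# + x ≡ 0# → x ≡ - 1#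
  1+x≡0⇒x≡-1 {x} = +-inverseʳ-unique 1# x

  -x*-y : ∀ x y → (- x) * (- y) ≡ x * y
  -x*-y x y = begin
    (- x) * (- y)  ≡⟨ -‿distribˡ-* x (- y) ⟨
    - (x * - y)    ≡⟨ cong -_ (-‿distribʳ-* x y) ⟨
    - - (x * y)    ≡⟨ -‿involutive (x * y) ⟩
    x * y          ∎
    where open ≡-Reasoning

  1≢0 : 1# ≢ 0#
  1≢0 = R-1≢0 d

  1+x≢0 : ∀ {x} → x ≡ 0# → 1# + x ≢ 0#
  1+x≢0 {x} x≡0 1+x≡0 = 1≢0 (trans (sym (trans (cong (λ z → 1# + z) x≡0) (+-identityʳ 1#))) 1+x≡0)

  tc : R d → R d → Mat d
  tc = tcMat d

  corner : R d → Mat d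
  corner μ = mat 0# 0# 0# μ

  -- λA_t · μA_s = 0 exactly when 1 + t s² = 0
  _⇝_ : R d → R d → Set
  t ⇝ s = 1# + t * (s * s) ≡ 0#

  _⇌_ : R d → R d → Set
  t ⇌ s = t ⇝ s ⊎ s ⇝ t

  private
    factor : ∀ {x y z} → y ≡ x * z → x + y ≡ x * (1# + z)
    factor {x} {y} {z} y≡xz = begin
      x + y              ≡⟨ cong₂ _+_ (*-identityʳ x) (sym y≡xz) ⟨
      x * 1# + x * z     ≡⟨ distribˡ x 1# z ⟨
      x * (1# + z)       ∎
      where open ≡-Reasoning

    0+_ : ∀ {x y} → x ≡ 0# → x + y ≡ y
    0+_ {y = y} x≡0 = trans (cong (_+ y) x≡0) (+-identityˡ y)

    x*0+0*y : ∀ x y → x * 0# + 0# * y ≡ 0#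
    x*0+0*y x y = trans (0+ zeroʳ x) (zeroˡ y)

    0*x+y*0 : ∀ x y → 0# * x + y * 0# ≡ 0#
    0*x+y*0 x y = trans (0+ zeroˡ x) (zeroʳ y)

  tc*tc : ∀ l m t s → let u = 1# + t * (s * s) in
    mulM d (tc l t) (tc m s) ≡
    mat (l * m * u) (l * (m * s) * u) (l * (t * t) * m * u) (l * (t * t) * (m * s) * u)
  tc*tc l m t s = mat-cong
    (factor (solve 4 (λ l m t s → ((l ⊕ t) ⊕ (m ⊕ (s ⊕ s)))
                               ⊜ ((l ⊕ m) ⊕ (t ⊕ (s ⊕ s)))) refl l m t s))
    (factor (solve 4 (λ l m t s → ((l ⊕ t) ⊕ (m ⊕ (s ⊕ (s ⊕ s))))
                               ⊜ ((l ⊕ (m ⊕ s)) ⊕ (t ⊕ (s ⊕ s)))) refl l m t s))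
    (factor (solve 4 (λ l m t s → ((l ⊕ (t ⊕ (t ⊕ t))) ⊕ (m ⊕ (s ⊕ s)))
                               ⊜ (((l ⊕ (t ⊕ t)) ⊕ m) ⊕ (t ⊕ (s ⊕ s)))) refl l m t s))
    (factor (solve 4 (λ l m t s → ((l ⊕ (t ⊕ (t ⊕ t))) ⊕ (m ⊕ (s ⊕ (s ⊕ s))))
                               ⊜ (((l ⊕ (t ⊕ t)) ⊕ (m ⊕ s)) ⊕ (t ⊕ (s ⊕ s)))) refl l m t s))

  ⇝⇒tc*tc≡0 : ∀ {l m t s} → t ⇝ s → mulM d (tc l t) (tc m s) ≡ zeroM d
  ⇝⇒tc*tc≡0 {l} {m} {t} {s} t⇝s = trans (tc*tc l m t s) (mat-cong (kill _) (kill _) (kill _) (kill _))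
    where
    kill : ∀ x → x * (1# + t * (s * s)) ≡ 0#
    kill x = trans (cong (x *_) t⇝s) (zeroʳ x)

  tc*tc≡0⇒⇝ : ∀ {l m t s} → l ≢ 0# → m ≢ 0# → mulM d (tc l t) (tc m s) ≡ zeroM d → t ⇝ s
  tc*tc≡0⇒⇝ {l} {m} {t} {s} l≢0 m≢0 tt≡0
    with R-domain d (l * m) _ (trans (sym (cong M2.e11 (tc*tc l m t s))) (cong M2.e11 tt≡0))
  ... | inj₁ lm≡0 = ⊥-elim (*-≢0 l≢0 m≢0 lm≡0)
  ... | inj₂ t⇝s = t⇝s

  tc*corner≡0⇒ : ∀ {l t μ} → l ≢ 0# → μ ≢ 0# → mulM d (tc l t) (corner μ) ≡ zeroM d → t ≡ 0#
  tc*corner≡0⇒ {l} {t} {μ} l≢0 μ≢0 tc≡0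
    with R-domain d (l * t) μ (trans (sym (0+ zeroʳ l)) (cong M2.e12 tc≡0))
  ... | inj₂ μ≡0 = ⊥-elim (μ≢0 μ≡0)
  ... | inj₁ lt≡0 with R-domain d l t lt≡0
  ...   | inj₁ l≡0 = ⊥-elim (l≢0 l≡0)
  ...   | inj₂ t≡0 = t≡0

  corner*tc≡0⇒ : ∀ {l t μ} → μ ≢ 0# → l ≢ 0# → mulM d (corner μ) (tc l t) ≡ zeroM d → t ≡ 0#
  corner*tc≡0⇒ {l} {t} {μ} μ≢0 l≢0 ct≡0
    with R-domain d (μ * l) (t * t) μl·tt≡0
    where
    μl·tt≡0 : μ * l * (t * t) ≡ 0#
    μl·tt≡0 = trans (solve 3 (λ μ l t → ((μ ⊕ l) ⊕ (t ⊕ t)) ⊜ (μ ⊕ (l ⊕ (t ⊕ t)))) refl μ l t)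
                    (trans (sym (0+ zeroˡ l)) (cong M2.e21 ct≡0))
  ... | inj₁ μl≡0 = ⊥-elim (*-≢0 μ≢0 l≢0 μl≡0)
  ... | inj₂ tt≡0 with R-domain d t t tt≡0
  ...   | inj₁ t≡0 = t≡0
  ...   | inj₂ t≡0 = t≡0

  corner*corner≢0 : ∀ {μ ν} → μ ≢ 0# → ν ≢ 0# → mulM d (corner μ) (corner ν) ≢ zeroM d
  corner*corner≢0 {μ} {ν} μ≢0 ν≢0 cc≡0 = *-≢0 μ≢0 ν≢0 (trans (sym (0+ zeroˡ 0#)) (cong M2.e22 cc≡0))

  tc-0 : ∀ l → tc l 0# ≡ mat l 0# 0# 0#
  tc-0 l = mat-cong refl (zeroʳ l) (l*[0*x]≡0 0#) (l*[0*x]≡0 (0# * 0#))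
    where
    l*[0*x]≡0 : ∀ x → l * (0# * x) ≡ 0#
    l*[0*x]≡0 x = trans (cong (l *_) (zeroˡ x)) (zeroʳ l)

  tc0*corner≡0 : ∀ l μ → mulM d (tc l 0#) (corner μ) ≡ zeroM d
  tc0*corner≡0 l μ = subst (λ M → mulM d M (corner μ) ≡ zeroM d) (sym (tc-0 l)) $
    mat-cong (x*0+0*y l 0#) (x*0+0*y l μ) (x*0+0*y 0# 0#) (x*0+0*y 0# μ)

  corner*tc0≡0 : ∀ l μ → mulM d (corner μ) (tc l 0#) ≡ zeroM d
  corner*tc0≡0 l μ = subst (λ M → mulM d (corner μ) M ≡ zeroM d) (sym (tc-0 l)) $
    mat-cong (0*x+y*0 l 0#) (0*x+y*0 0# 0#) (0*x+y*0 l μ) (0*x+y*0 0# μ)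

  tc-injectiveˡ : ∀ {l m t s} → tc l t ≡ tc m s → l ≡ m
  tc-injectiveˡ = cong M2.e11

  tc-injectiveʳ : ∀ {l m t s} → l ≢ 0# → tc l t ≡ tc m s → t ≡ s
  tc-injectiveʳ l≢0 eq with tc-injectiveˡ eq
  ... | refl = *-cancelˡ l≢0 (cong M2.e12 eq)

  tc≢corner : ∀ {l t μ} → l ≢ 0# → tc l t ≢ corner μ
  tc≢corner l≢0 eq = l≢0 (cong M2.e11 eq)

  tc∈Stc : ∀ {l t} → l ≢ 0# → Stc d (tc l t)
  tc∈Stc {l} {t} l≢0 = inj₁ (t , l , l≢0 , refl)

  Adj-sym : ∀ {u v} → Adj d u v → Adj d v u
  Adj-sym (u≢v , uv≡0⊎vu≡0) = (λ v≡u → u≢v (sym v≡u)) , Sum.swap uv≡0⊎vu≡0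

  Step-sym : ∀ {u v} → Step d u v → Step d v u
  Step-sym (u∈S , v∈S , u~v) = v∈S , u∈S , Adj-sym u~v

  adj-tc-tc : ∀ {l m t s} → l ≢ 0# → m ≢ 0# → Adj d (tc l t) (tc m s) → t ⇌ s
  adj-tc-tc l≢0 m≢0 (_ , inj₁ tt≡0) = inj₁ (tc*tc≡0⇒⇝ l≢0 m≢0 tt≡0)
  adj-tc-tc l≢0 m≢0 (_ , inj₂ tt≡0) = inj₂ (tc*tc≡0⇒⇝ m≢0 l≢0 tt≡0)

  adj-tc-corner : ∀ {l t μ} → l ≢ 0# → μ ≢ 0# → Adj d (tc l t) (corner μ) → t ≡ 0#
  adj-tc-corner l≢0 μ≢0 (_ , inj₁ tc≡0) = tc*corner≡0⇒ l≢0 μ≢0 tc≡0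
  adj-tc-corner l≢0 μ≢0 (_ , inj₂ ct≡0) = corner*tc≡0⇒ μ≢0 l≢0 ct≡0

  ¬adj-corner-corner : ∀ {μ ν} → μ ≢ 0# → ν ≢ 0# → ¬ Adj d (corner μ) (corner ν)
  ¬adj-corner-corner μ≢0 ν≢0 (_ , inj₁ cc≡0) = corner*corner≢0 μ≢0 ν≢0 cc≡0
  ¬adj-corner-corner μ≢0 ν≢0 (_ , inj₂ cc≡0) = corner*corner≢0 ν≢0 μ≢0 cc≡0

  ⇌⇒adj : ∀ {l m t s} → l ≢ 0# → t ≢ s → t ⇌ s → Adj d (tc l t) (tc m s)
  ⇌⇒adj l≢0 t≢s t⇌s = (λ eq → t≢s (tc-injectiveʳ l≢0 eq)) , Sum.map ⇝⇒tc*tc≡0 ⇝⇒tc*tc≡0 t⇌s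

  tc-step : ∀ {l m t s} → l ≢ 0# → m ≢ 0# → t ≢ s → t ⇌ s → Step d (tc l t) (tc m s)
  tc-step l≢0 m≢0 t≢s t⇌s = tc∈Stc l≢0 , tc∈Stc m≢0 , ⇌⇒adj l≢0 t≢s t⇌s

  IsUnit : R d → Set
  IsUnit x = Σ[ y ∈ R d ] x * y ≡ 1#

  ⇌-sym : ∀ {t s} → t ⇌ s → s ⇌ t
  ⇌-sym = Sum.swap

  ⇌⇒unit : ∀ {t s} → t ⇌ s → IsUnit s
  ⇌⇒unit {t} {s} (inj₁ t⇝s) = - (t * s) , (begin
    s * - (t * s)    ≡⟨ -‿distribʳ-* s (t * s) ⟨
    - (s * (t * s))  ≡⟨ cong -_ (solve 2 (λ s t → (s ⊕ (t ⊕ s)) ⊜ (t ⊕ (s ⊕ s))) refl s t) ⟩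
    - (t * (s * s))  ≡⟨ cong -_ (1+x≡0⇒x≡-1 t⇝s) ⟩
    - - 1#           ≡⟨ -‿involutive 1# ⟩
    1#               ∎)
    where open ≡-Reasoning
  ⇌⇒unit {t} {s} (inj₂ s⇝t) = - (t * t) , (begin
    s * - (t * t)    ≡⟨ -‿distribʳ-* s (t * t) ⟨
    - (s * (t * t))  ≡⟨ cong -_ (1+x≡0⇒x≡-1 s⇝t) ⟩
    - - 1#           ≡⟨ -‿involutive 1# ⟩
    1#               ∎)
    where open ≡-Reasoning

  square≡-1⇒unit : ∀ {x} → x * x ≡ - 1# → IsUnit x
  square≡-1⇒unit {x} xx≡-1 = - x , trans (sym (-‿distribʳ-* x x)) (trans (cong -_ xx≡-1) (-‿involutive 1#))

  ¬0⇌ : ∀ {s} → ¬ (0# ⇌ s)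
  ¬0⇌ {s} (inj₁ 0⇝s) = 1+x≢0 (zeroˡ (s * s)) 0⇝s
  ¬0⇌ {s} (inj₂ s⇝0) = 1+x≢0 (trans (cong (s *_) (zeroˡ 0#)) (zeroʳ s)) s⇝0

  connected-through : ∀ {C : Mat d → Set} (h : Mat d) → (∀ v → C v → Star (Step d) v h) →
    ∀ u v → C u → C v → Star (Step d) u v
  connected-through h path u v u∈C v∈C = path u u∈C ◅◅ reverse Step-sym (path v v∈C)

  tc-component : ∀ {C : Mat d → Set} (T : R d → Set) →
    (∀ {M} → C M → Σ[ t ∈ R d ] T t × Stc1t d t M) →
    (∀ {t M} → T t → Stc1t d t M → C M) →
    (∀ {t} → T t → t ≢ 0#) →
    (∀ {t s} → T t → t ⇌ s → T s) →
    (h : Mat d) → C h → (∀ v → C v → Star (Step d) v h) → IsComponent d C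
  tc-component {C} T parameter member T∌0 T-closed h h∈C path =
    (h , h∈C) , C⊆Stc , connected-through h path , closed
    where
    C⊆Stc : ∀ v → C v → Stc d v
    C⊆Stc v v∈C with parameter v∈C
    ... | _ , _ , l , l≢0 , refl = tc∈Stc l≢0
    closed : ∀ u v → C u → Stc d v → Adj d u v → C v
    closed u v u∈C v∈S adj with parameter u∈C | v∈S
    ... | _ , t∈T , _ , l≢0 , refl | inj₁ (_ , m , m≢0 , refl) =
      member (T-closed t∈T (adj-tc-tc l≢0 m≢0 adj)) (m , m≢0 , refl)
    ... | _ , t∈T , _ , l≢0 , refl | inj₂ (_ , μ≢0 , refl) =
      ⊥-elim (T∌0 t∈T (adj-tc-corner l≢0 μ≢0 adj))

  tc-infinite : ∀ {C : Mat d → Set} t → (∀ {l} → l ≢ 0# → C (tc l t)) → Infinite d C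
  tc-infinite t in-C =
    (λ n → tc (R-suc d n) t) , (λ n → in-C (R-suc≢0 d n)) , λ eq → R-suc-injective d (tc-injectiveˡ eq)

  tc-directed : ∀ {C : Mat d → Set} {t s} → C (tc 1# t) → C (tc 1# s) → t ⇝ s → ¬ s ⇝ t → Directed d C
  tc-directed {t = t} {s} t∈C s∈C t⇝s s⇝̸t =
    tc 1# t , tc 1# s , t∈C , s∈C , (t≢s , ⇝⇒tc*tc≡0 t⇝s) ,
    λ (_ , st≡0) → s⇝̸t (tc*tc≡0⇒⇝ 1≢0 1≢0 st≡0)
    where
    t≢s : tc 1# t ≢ tc 1# s
    t≢s eq = s⇝̸t (subst₂ _⇝_ t≡s (sym t≡s) t⇝s)
      where t≡s = tc-injectiveʳ 1≢0 eq

  no-short-cycle : ∀ {C : Mat d → Set} n → n ℕ.< 3 → ¬ HasCycle d C n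
  no-short-cycle 0 _ ()
  no-short-cycle 1 _ (() , _)
  no-short-cycle 2 _ (s≤s () , _)
  no-short-cycle (suc (suc (suc _))) (s≤s (s≤s (s≤s ())))

  tc-girth3 : ∀ {C : Mat d → Set} t → t ⇝ t → (∀ {l} → l ≢ 0# → C (tc l t)) → Girth d C 3
  tc-girth3 {C} t t⇝t in-C = triangle , no-short-cycle
    where
    vertex : Fin 3 → Mat d
    vertex i = tc (R-suc d (toℕ i)) t
    vertex-injective : ∀ {i j} → vertex i ≡ vertex j → i ≡ j
    vertex-injective eq = Finₚ.toℕ-injective (R-suc-injective d (tc-injectiveˡ eq))
    adj : ∀ {i j} → i ≢ j → Adj d (vertex i) (vertex j)
    adj i≢j = (λ eq → i≢j (vertex-injective eq)) , inj₁ (⇝⇒tc*tc≡0 t⇝t)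
    triangle : HasCycle d C 3
    triangle = s≤s (s≤s z≤n) , vertex , vertex-injective , (λ i → in-C (R-suc≢0 d (toℕ i))) ,
      (λ { Fin.zero → adj (λ ()) ; (Fin.suc Fin.zero) → adj (λ ()) }) , adj (λ ())

  non-unit-isolated : ∀ {t} → t ≢ 0# → ¬ IsUnit t → ∀ v → Stc1t d t v → IsolatedVertex d v
  non-unit-isolated {t} t≢0 t∉U v (l , l≢0 , refl) =
    (v , refl) , (λ { _ refl → tc∈Stc l≢0 }) , (λ { _ _ refl refl → ε }) , closed
    where
    closed : ∀ u w → u ≡ v → Stc d w → Adj d u w → w ≡ v
    closed _ _ refl (inj₁ (_ , m , m≢0 , refl)) adj =
      ⊥-elim (t∉U (⇌⇒unit (⇌-sym (adj-tc-tc l≢0 m≢0 adj))))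
    closed _ _ refl (inj₂ (_ , μ≢0 , refl)) adj = ⊥-elim (t≢0 (adj-tc-corner l≢0 μ≢0 adj))

  private
    P Q : Mat d → Set
    P = Stc1t d 0#
    Q = Stc2 d

  P-Q-products : ∀ {u v} → P u → Q v → mulM d u v ≡ zeroM d × mulM d v u ≡ zeroM d
  P-Q-products (l , _ , refl) (μ , _ , refl) = tc0*corner≡0 l μ , corner*tc0≡0 l μ

  P-Q-adj : ∀ {u v} → P u → Q v → Adj d u v
  P-Q-adj p@(_ , l≢0 , refl) q@(_ , _ , refl) = tc≢corner l≢0 , inj₁ (proj₁ (P-Q-products p q))

  ¬P-P-adj : ∀ {u v} → P u → P v → ¬ Adj d u v
  ¬P-P-adj (_ , l≢0 , refl) (_ , m≢0 , refl) adj = ¬0⇌ (adj-tc-tc l≢0 m≢0 adj)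

  ¬Q-Q-adj : ∀ {u v} → Q u → Q v → ¬ Adj d u v
  ¬Q-Q-adj (_ , μ≢0 , refl) (_ , ν≢0 , refl) = ¬adj-corner-corner μ≢0 ν≢0

  Γ₁-adj⇒ : ∀ {u v} → Γ₁ d u → Γ₁ d v → Adj d u v → (P u × Q v) ⊎ (Q u × P v)
  Γ₁-adj⇒ (inj₁ p) (inj₁ p′) adj = ⊥-elim (¬P-P-adj p p′ adj)
  Γ₁-adj⇒ (inj₁ p) (inj₂ q) _ = inj₁ (p , q)
  Γ₁-adj⇒ (inj₂ q) (inj₁ p) _ = inj₂ (q , p)
  Γ₁-adj⇒ (inj₂ q) (inj₂ q′) adj = ⊥-elim (¬Q-Q-adj q q′ adj)

  Γ₁-adj⇐ : ∀ {u v} → (P u × Q v) ⊎ (Q u × P v) → Adj d u v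
  Γ₁-adj⇐ (inj₁ (p , q)) = P-Q-adj p q
  Γ₁-adj⇐ (inj₂ (q , p)) = Adj-sym (P-Q-adj p q)

  Γ₁-triangle-free : ∀ {x y z} → Γ₁ d x → Γ₁ d y → Γ₁ d z → Adj d x y → Adj d y z → ¬ Adj d z x
  Γ₁-triangle-free (inj₁ p) (inj₁ p′) _ xy _ _ = ¬P-P-adj p p′ xy
  Γ₁-triangle-free (inj₂ q) (inj₂ q′) _ xy _ _ = ¬Q-Q-adj q q′ xy
  Γ₁-triangle-free _ (inj₁ p) (inj₁ p′) _ yz _ = ¬P-P-adj p p′ yz
  Γ₁-triangle-free _ (inj₂ q) (inj₂ q′) _ yz _ = ¬Q-Q-adj q q′ yz
  Γ₁-triangle-free (inj₁ p) (inj₂ _) (inj₁ p′) _ _ zx = ¬P-P-adj p′ p zx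
  Γ₁-triangle-free (inj₂ q) (inj₁ _) (inj₂ q′) _ _ zx = ¬Q-Q-adj q′ q zx

  Γ₁⊆Stc : ∀ {v} → Γ₁ d v → Stc d v
  Γ₁⊆Stc (inj₁ (_ , l≢0 , refl)) = tc∈Stc l≢0
  Γ₁⊆Stc (inj₂ q) = inj₂ q

  Γ₁-isComponent : IsComponent d (Γ₁ d)
  Γ₁-isComponent = (hub , inj₂ hub∈Q) , (λ _ → Γ₁⊆Stc) , connected-through hub path , closed
    where
    hub∈Q : Q (corner 1#)
    hub∈Q = 1# , 1≢0 , refl
    hub = corner 1#
    tc10∈P : P (tc 1# 0#)
    tc10∈P = 1# , 1≢0 , refl
    step : ∀ {u v} → Γ₁ d u → Γ₁ d v → Adj d u v → Step d u v
    step u∈Γ v∈Γ adj = Γ₁⊆Stc u∈Γ , Γ₁⊆Stc v∈Γ , adj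
    path : ∀ v → Γ₁ d v → Star (Step d) v hub
    path v (inj₁ p) = step (inj₁ p) (inj₂ hub∈Q) (P-Q-adj p hub∈Q) ◅ ε
    path v (inj₂ q) = step (inj₂ q) (inj₁ tc10∈P) (Γ₁-adj⇐ (inj₂ (q , tc10∈P))) ◅ path _ (inj₁ tc10∈P)
    closed : ∀ u v → Γ₁ d u → Stc d v → Adj d u v → Γ₁ d v
    closed u v (inj₁ (_ , l≢0 , refl)) (inj₁ (_ , m , m≢0 , refl)) adj =
      ⊥-elim (¬0⇌ (adj-tc-tc l≢0 m≢0 adj))
    closed u v (inj₁ _) (inj₂ q) _ = inj₂ q
    closed u v (inj₂ (_ , μ≢0 , refl)) (inj₁ (_ , m , m≢0 , refl)) adj =
      inj₁ (m , m≢0 , cong (tc m) (adj-tc-corner m≢0 μ≢0 (Adj-sym adj)))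
    closed u v (inj₂ q) (inj₂ q′) adj = ⊥-elim (¬Q-Q-adj q q′ adj)

  Γ₁-undirected : Undirected d (Γ₁ d)
  Γ₁-undirected u v u∈Γ v∈Γ (u≢v , uv≡0) with Γ₁-adj⇒ u∈Γ v∈Γ (u≢v , inj₁ uv≡0)
  ... | inj₁ (p , q) = (λ v≡u → u≢v (sym v≡u)) , proj₂ (P-Q-products p q)
  ... | inj₂ (q , p) = (λ v≡u → u≢v (sym v≡u)) , proj₁ (P-Q-products p q)

  Γ₁-completeBipartite : CompleteBipartite d (Γ₁ d)
  Γ₁-completeBipartite =
    P , Q , (λ _ v∈Γ → v∈Γ) , (λ _ → inj₁) , (λ _ → inj₂) , P∩Q≡∅ ,
    (tc 1# 0# , 1# , 1≢0 , refl) , (corner 1# , 1# , 1≢0 , refl) ,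
    λ _ _ u∈Γ v∈Γ → Γ₁-adj⇒ u∈Γ v∈Γ , Γ₁-adj⇐
    where
    P∩Q≡∅ : ∀ v → P v → Q v → ⊥
    P∩Q≡∅ _ (_ , l≢0 , refl) (_ , _ , eq) = tc≢corner l≢0 eq

  Γ₁-square : HasCycle d (Γ₁ d) 4
  Γ₁-square = s≤s (s≤s z≤n) , vertex , vertex-injective , vertex∈Γ₁ , edge , Γ₁-adj⇐ (inj₂ (q 3 , p 0))
    where
    trace : Mat d → R d
    trace M = M2.e11 M + M2.e22 M
    vertex : Fin 4 → Mat d
    vertex Fin.zero = tc (R-suc d 0) 0#
    vertex (Fin.suc Fin.zero) = corner (R-suc d 1)
    vertex (Fin.suc (Fin.suc Fin.zero)) = tc (R-suc d 2) 0#
    vertex (Fin.suc (Fin.suc (Fin.suc Fin.zero))) = corner (R-suc d 3)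
    trace-tc0 : ∀ l → trace (tc l 0#) ≡ l
    trace-tc0 l = trans (cong trace (tc-0 l)) (+-identityʳ l)
    trace-corner : ∀ μ → trace (corner μ) ≡ μ
    trace-corner = +-identityˡ
    trace-vertex : ∀ i → trace (vertex i) ≡ R-suc d (toℕ i)
    trace-vertex Fin.zero = trace-tc0 _
    trace-vertex (Fin.suc Fin.zero) = trace-corner _
    trace-vertex (Fin.suc (Fin.suc Fin.zero)) = trace-tc0 _
    trace-vertex (Fin.suc (Fin.suc (Fin.suc Fin.zero))) = trace-corner _
    vertex-injective : ∀ {i j} → vertex i ≡ vertex j → i ≡ j
    vertex-injective {i} {j} eq =
      Finₚ.toℕ-injective (R-suc-injective d (trans (sym (trace-vertex i)) (trans (cong trace eq) (trace-vertex j))))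
    p : ∀ n → P (tc (R-suc d n) 0#)
    p n = R-suc d n , R-suc≢0 d n , refl
    q : ∀ n → Q (corner (R-suc d n))
    q n = R-suc d n , R-suc≢0 d n , refl
    vertex∈Γ₁ : ∀ i → Γ₁ d (vertex i)
    vertex∈Γ₁ Fin.zero = inj₁ (p 0)
    vertex∈Γ₁ (Fin.suc Fin.zero) = inj₂ (q 1)
    vertex∈Γ₁ (Fin.suc (Fin.suc Fin.zero)) = inj₁ (p 2)
    vertex∈Γ₁ (Fin.suc (Fin.suc (Fin.suc Fin.zero))) = inj₂ (q 3)
    edge : ∀ (i : Fin 3) → Adj d (vertex (Fin.inject₁ i)) (vertex (Fin.suc i))
    edge Fin.zero = Γ₁-adj⇐ (inj₁ (p 0 , q 1))
    edge (Fin.suc Fin.zero) = Γ₁-adj⇐ (inj₂ (q 1 , p 2))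
    edge (Fin.suc (Fin.suc Fin.zero)) = Γ₁-adj⇐ (inj₁ (p 2 , q 3))

  Γ₁-girth4 : Girth d (Γ₁ d) 4
  Γ₁-girth4 = Γ₁-square , shorter
    where
    shorter : ∀ n → n ℕ.< 4 → ¬ HasCycle d (Γ₁ d) n
    shorter 0 _ = no-short-cycle {Γ₁ d} 0 (s≤s z≤n)
    shorter 1 _ = no-short-cycle {Γ₁ d} 1 (s≤s (s≤s z≤n))
    shorter 2 _ = no-short-cycle {Γ₁ d} 2 (s≤s (s≤s (s≤s z≤n)))
    shorter 3 _ (_ , f , _ , f∈Γ , f-edge , f-edge₂₀) =
      Γ₁-triangle-free (f∈Γ _) (f∈Γ _) (f∈Γ _) (f-edge Fin.zero) (f-edge (Fin.suc Fin.zero)) f-edge₂₀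
    shorter (suc (suc (suc (suc _)))) (s≤s (s≤s (s≤s (s≤s ()))))

  Γ₁-component : BipartiteComponent d (Γ₁ d)
  Γ₁-component =
    Γ₁-isComponent , tc-infinite {Γ₁ d} 0# (λ l≢0 → inj₁ (_ , l≢0 , refl)) ,
    Γ₁-undirected , Γ₁-completeBipartite , Γ₁-girth4

  module CubeRootPair (t : R d) (t³≡1 : t * (t * t) ≡ 1#) where

    Pair : R d → Set
    Pair s = s ≡ - t ⊎ s ≡ t

    -t⇝t : (- t) ⇝ t
    -t⇝t = begin
      1# + (- t) * (t * t)   ≡⟨ cong (λ z → 1# + z) (-‿distribˡ-* t (t * t)) ⟨
      1# + - (t * (t * t))   ≡⟨ cong (λ x → 1# + - x) t³≡1 ⟩
      1# + - 1#              ≡⟨ -‿inverseʳ 1# ⟩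
      0#                     ∎
      where open ≡-Reasoning

    -t⇝-t : (- t) ⇝ (- t)
    -t⇝-t = subst (λ x → 1# + (- t) * x ≡ 0#) (sym (-x*-y t t)) -t⇝t

    t⇝̸-t : ¬ t ⇝ (- t)
    t⇝̸-t t⇝-t = R-2≢0 d (trans (cong (λ z → 1# + z) (sym (trans (cong (t *_) (-x*-y t t)) t³≡1))) t⇝-t)

    -t≢t : - t ≢ t
    -t≢t -t≡t = t⇝̸-t (subst₂ _⇝_ -t≡t (sym -t≡t) -t⇝t)

    t≢-t : t ≢ - t
    t≢-t t≡-t = -t≢t (sym t≡-t)

    Pair∌0 : ∀ {s} → Pair s → s ≢ 0#
    Pair∌0 (inj₁ refl) -t≡0 = ¬0⇌ (inj₁ (subst (_⇝ t) -t≡0 -t⇝t))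
    Pair∌0 (inj₂ refl) t≡0 = ¬0⇌ (inj₂ (subst ((- t) ⇝_) t≡0 -t⇝t))

    private
      Pair-square : ∀ {s} → Pair s → s * s ≡ t * t
      Pair-square (inj₁ refl) = -x*-y t t
      Pair-square (inj₂ refl) = refl

      ⇝±t : ∀ {s t′} → Pair t′ → s ⇝ t′ → s ≡ - t
      ⇝±t {s} {t′} t′∈P s⇝t′ = begin
        s                  ≡⟨ *-identityʳ s ⟨
        s * 1#             ≡⟨ cong (s *_) t³≡1 ⟨
        s * (t * (t * t))  ≡⟨ solve 2 (λ s t → (s ⊕ (t ⊕ (t ⊕ t))) ⊜ ((s ⊕ (t ⊕ t)) ⊕ t)) refl s t ⟩
        s * (t * t) * t    ≡⟨ cong (_* t) st²≡-1 ⟩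
        - 1# * t           ≡⟨ -1*x≈-x t ⟩
        - t                ∎
        where
        open ≡-Reasoning
        st²≡-1 : s * (t * t) ≡ - 1#
        st²≡-1 = 1+x≡0⇒x≡-1 (subst (λ x → 1# + s * x ≡ 0#) (Pair-square t′∈P) s⇝t′)

      -t⇝⇒square : ∀ {s} → (- t) ⇝ s → s * s ≡ t * t
      -t⇝⇒square {s} -t⇝s = begin
        s * s                    ≡⟨ *-identityˡ (s * s) ⟨
        1# * (s * s)             ≡⟨ cong (_* (s * s)) t³≡1 ⟨
        t * (t * t) * (s * s)    ≡⟨ solve 2 (λ t s → ((t ⊕ (t ⊕ t)) ⊕ (s ⊕ s))
                                                   ⊜ ((t ⊕ t) ⊕ (t ⊕ (s ⊕ s)))) refl t s ⟩
        t * t * (t * (s * s))    ≡⟨ cong (t * t *_) ts²≡1 ⟩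
        t * t * 1#               ≡⟨ *-identityʳ (t * t) ⟩
        t * t                    ∎
        where
        open ≡-Reasoning
        ts²≡1 : t * (s * s) ≡ 1#
        ts²≡1 = begin
          t * (s * s)         ≡⟨ -‿involutive (t * (s * s)) ⟨
          - - (t * (s * s))   ≡⟨ cong -_ (-‿distribˡ-* t (s * s)) ⟩
          - ((- t) * (s * s)) ≡⟨ cong -_ (1+x≡0⇒x≡-1 -t⇝s) ⟩
          - - 1#              ≡⟨ -‿involutive 1# ⟩
          1#                  ∎

      t⇝⇒sqrt-1 : ∀ {s} → t ⇝ s → (s * (t * t)) * (s * (t * t)) ≡ - 1#
      t⇝⇒sqrt-1 {s} t⇝s = begin
        (s * (t * t)) * (s * (t * t))  ≡⟨ solve 2 (λ s t → ((s ⊕ (t ⊕ t)) ⊕ (s ⊕ (t ⊕ t)))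
                                                         ⊜ ((t ⊕ (s ⊕ s)) ⊕ (t ⊕ (t ⊕ t)))) refl s t ⟩
        (t * (s * s)) * (t * (t * t))  ≡⟨ cong₂ _*_ (1+x≡0⇒x≡-1 t⇝s) t³≡1 ⟩
        - 1# * 1#                      ≡⟨ *-identityʳ (- 1#) ⟩
        - 1#                           ∎
        where open ≡-Reasoning

    Pair-closed : (∀ x → x * x ≢ - 1#) → ∀ {t′ s} → Pair t′ → t′ ⇌ s → Pair s
    Pair-closed _ t′∈P (inj₂ s⇝t′) = inj₁ (⇝±t t′∈P s⇝t′)
    Pair-closed _ (inj₁ refl) (inj₁ -t⇝s) = Sum.swap (square-root (-t⇝⇒square -t⇝s))
    Pair-closed no-√-1 (inj₂ refl) (inj₁ t⇝s) = ⊥-elim (no-√-1 _ (t⇝⇒sqrt-1 t⇝s))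

    pair-component : (∀ {t′ s} → Pair t′ → t′ ⇌ s → Pair s) → DirectedComponent d (PairSet d t)
    pair-component Pair-closed′ =
      tc-component Pair parameter member Pair∌0 Pair-closed′ hub (inj₁ (1# , 1≢0 , refl)) path ,
      tc-infinite {PairSet d t} (- t) (λ l≢0 → inj₁ (_ , l≢0 , refl)) ,
      tc-directed (inj₁ (1# , 1≢0 , refl)) (inj₂ (1# , 1≢0 , refl)) -t⇝t t⇝̸-t ,
      tc-girth3 {PairSet d t} (- t) -t⇝-t (λ l≢0 → inj₁ (_ , l≢0 , refl))
      where
      parameter : ∀ {M} → PairSet d t M → Σ[ t′ ∈ R d ] Pair t′ × Stc1t d t′ M
      parameter (inj₁ M∈S) = - t , inj₁ refl , M∈S
      parameter (inj₂ M∈S) = t , inj₂ refl , M∈S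
      member : ∀ {t′ M} → Pair t′ → Stc1t d t′ M → PairSet d t M
      member (inj₁ refl) = inj₁
      member (inj₂ refl) = inj₂
      hub : Mat d
      hub = tc 1# (- t)
      path : ∀ v → PairSet d t v → Star (Step d) v hub
      path _ (inj₁ (_ , l≢0 , refl)) =
        tc-step l≢0 1≢0 -t≢t (inj₁ -t⇝t) ◅ tc-step 1≢0 1≢0 t≢-t (inj₂ -t⇝t) ◅ ε
      path _ (inj₂ (_ , l≢0 , refl)) = tc-step l≢0 1≢0 t≢-t (inj₂ -t⇝t) ◅ ε

case1 : ∀ d → d ≢ 1 → d ≢ 3 → Case1 d
case1 d d≢1 d≢3 =
  Γ₁-component ,
  pair-component (λ _ t⇌s → unit⇒±1 (⇌⇒unit t⇌s)) ,
  λ t t≢0 t≢1 t≢-1 → non-unit-isolated t≢0 λ (y , ty≡1) →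
    [ t≢1 , t≢-1 ]′ (R-units d d≢1 d≢3 t y ty≡1)
  where
  open TcGraph d
  open CommutativeRing (R-commutativeRing d) using (*-identityʳ)
  open CubeRootPair (oneR d) (trans (cong (mulR d (oneR d)) (*-identityʳ _)) (*-identityʳ _))
  unit⇒±1 : ∀ {x} → IsUnit x → Pair x
  unit⇒±1 (y , xy≡1) = Sum.swap (R-units d d≢1 d≢3 _ y xy≡1)

ℤ[i]-unit-component : DirectedComponent 1 (λ M → PairSet 1 (oneR 1) M ⊎ PairSet 1 iG M)
ℤ[i]-unit-component =
  tc-component GaussianUnit parameter member GaussianUnit∌0
    (λ {t} {s} _ t⇌s → unit⇒GaussianUnit (⇌⇒unit {t} {s} t⇌s))
    hub (inj₁ (inj₁ (1ᵢ , 1≢0 , refl))) path ,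
  tc-infinite {C} -1ᵢ (λ l≢0 → inj₁ (inj₁ (_ , l≢0 , refl))) ,
  tc-directed {C} { -1ᵢ} {1ᵢ} (inj₁ (inj₁ (1ᵢ , 1≢0 , refl))) (inj₁ (inj₂ (1ᵢ , 1≢0 , refl)))
    refl (λ ()) ,
  tc-girth3 {C} -1ᵢ refl (λ l≢0 → inj₁ (inj₁ (_ , l≢0 , refl)))
  where
  open TcGraph 1
  1ᵢ -1ᵢ -i : R 1
  1ᵢ = oneR 1
  -1ᵢ = negR 1 1ᵢ
  -i = negR 1 iG
  C : Mat 1 → Set
  C M = PairSet 1 1ᵢ M ⊎ PairSet 1 iG M
  unit⇒GaussianUnit : ∀ {x} → IsUnit x → GaussianUnit x
  unit⇒GaussianUnit (y , xy≡1) = ℤ[i]-units _ y xy≡1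
  parameter : ∀ {M} → C M → Σ[ t ∈ R 1 ] GaussianUnit t × Stc1t 1 t M
  parameter (inj₁ (inj₁ M∈S)) = _ , inj₁ (inj₁ refl) , M∈S
  parameter (inj₁ (inj₂ M∈S)) = _ , inj₁ (inj₂ refl) , M∈S
  parameter (inj₂ (inj₁ M∈S)) = _ , inj₂ (inj₁ refl) , M∈S
  parameter (inj₂ (inj₂ M∈S)) = _ , inj₂ (inj₂ refl) , M∈S
  member : ∀ {t M} → GaussianUnit t → Stc1t 1 t M → C M
  member (inj₁ (inj₁ refl)) = inj₁ ∘ inj₁
  member (inj₁ (inj₂ refl)) = inj₁ ∘ inj₂
  member (inj₂ (inj₁ refl)) = inj₂ ∘ inj₁
  member (inj₂ (inj₂ refl)) = inj₂ ∘ inj₂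
  GaussianUnit∌0 : ∀ {t} → GaussianUnit t → t ≢ zeroR 1
  GaussianUnit∌0 (inj₁ (inj₁ refl)) ()
  GaussianUnit∌0 (inj₁ (inj₂ refl)) ()
  GaussianUnit∌0 (inj₂ (inj₁ refl)) ()
  GaussianUnit∌0 (inj₂ (inj₂ refl)) ()
  hub : Mat 1
  hub = tc 1ᵢ -1ᵢ
  1-to-hub : Star (Step 1) (tc 1ᵢ 1ᵢ) hub
  1-to-hub = tc-step {t = 1ᵢ} {s = -1ᵢ } 1≢0 1≢0 (λ ()) (inj₂ refl) ◅ ε
  path : ∀ v → C v → Star (Step 1) v hub
  path _ (inj₁ (inj₁ (_ , l≢0 , refl))) = tc-step {t = -1ᵢ } {s = 1ᵢ} l≢0 1≢0 (λ ()) (inj₁ refl) ◅ 1-to-hub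
  path _ (inj₁ (inj₂ (_ , l≢0 , refl))) = tc-step {t = 1ᵢ} {s = -1ᵢ } l≢0 1≢0 (λ ()) (inj₂ refl) ◅ ε
  path _ (inj₂ (inj₁ (_ , l≢0 , refl))) = tc-step {t = -i } {s = 1ᵢ} l≢0 1≢0 (λ ()) (inj₂ refl) ◅ 1-to-hub
  path _ (inj₂ (inj₂ (_ , l≢0 , refl))) = tc-step {t = iG} {s = 1ᵢ} l≢0 1≢0 (λ ()) (inj₂ refl) ◅ 1-to-hub

case2 : Case2
case2 =
  Γ₁-component ,
  ℤ[i]-unit-component ,
  λ t t≢0 t≢1 t≢-1 t≢i t≢-i → non-unit-isolated t≢0 λ (y , ty≡1) →
    [ [ t≢-1 , t≢1 ]′ , [ t≢-i , t≢i ]′ ]′ (ℤ[i]-units t y ty≡1)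
  where open TcGraph 1

ℤ[ω]-no-√-1 : ∀ x → mulR 3 x x ≢ negR 3 (oneR 3)
ℤ[ω]-no-√-1 x xx≡-1 = not-square (ℤ[ω]-units x _ (proj₂ (square≡-1⇒unit {x} xx≡-1))) xx≡-1
  where
  open TcGraph 3 using (square≡-1⇒unit)
  not-square : ∀ {x} → EisensteinUnit x → mulR 3 x x ≢ negR 3 (oneR 3)
  not-square (inj₁ refl) ()
  not-square (inj₂ (inj₁ refl)) ()
  not-square (inj₂ (inj₂ (inj₁ refl))) ()
  not-square (inj₂ (inj₂ (inj₂ (inj₁ refl)))) ()
  not-square (inj₂ (inj₂ (inj₂ (inj₂ (inj₁ refl))))) ()
  not-square (inj₂ (inj₂ (inj₂ (inj₂ (inj₂ refl))))) ()

case3 : Case3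
case3 =
  Γ₁-component ,
  cube-root-component (oneR 3) refl ,
  cube-root-component ω refl ,
  cube-root-component ω² refl ,
  λ t t≢0 t≢1 t≢-1 t≢ω t≢-ω t≢ω² t≢-ω² → non-unit-isolated t≢0 λ (y , ty≡1) →
    [ t≢1 , [ t≢-1 , [ t≢ω , [ t≢-ω , [ t≢ω² , t≢-ω² ]′ ]′ ]′ ]′ ]′ (ℤ[ω]-units t y ty≡1)
  where
  open TcGraph 3
  cube-root-component : ∀ t → mulR 3 t (mulR 3 t t) ≡ oneR 3 → DirectedComponent 3 (PairSet 3 t)
  cube-root-component t t³≡1 = pair-component (Pair-closed ℤ[ω]-no-√-1)
    where open CubeRootPair t t³≡1

theorem3p2 : (∀ (d : ℕ) → Admissible d → d ≢ 1 → d ≢ 3 → Case1 d) × Case2 × Case3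
theorem3p2 = (λ d _ → case1 d) , case2 , case3
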